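{- Let $R$ be a left-reduced ground rewrite system contained in $\succ$, and let $\succ\!\!\succ_R$ be the non-Horn $R$-normalization closure ordering. Let $\iota$ be a ground Equality Factoring inference with premise $(C\cdot\theta)$. Then $\mathrm{concl}(\iota)$ is $\succ\!\!\succ_R$-smaller than $(C\cdot\theta)$.
   Context: $\succ$ is a reduction ordering on terms, total on ground terms. Clauses are finite multisets of literals $s\approx t$, $s\not\approx t$ ($\approx$ symmetric). $\succ_L$ maps $s\approx t$ to $\{s,t\}$ and $s\not\approx t$ to $\{s,s,t,t\}$, compared via the multiset extension of $\succ$; $\succ_C$ is the multiset extension of $\succ_L$; $L$ is maximal in $C\lor L$ if no literal of $C$ is larger. Most general unifiers are idempotent. A ground closure $(C\cdot\theta)$: clause $C$ and substitution $\theta$, $C\theta$ ground; identified up to bijective renaming of $C$ when instances coincide. $R$ contained in $\succ$: $u\succ v$ for all rules; left-reduced: no left-hand side reducible by the other rules; $t{\downarrow}_R$ normal form. Ground Equality Factoring: from $(C'\lor r\approx r'\lor s\approx s'\cdot\theta)$ derive $((C'\lor s'\not\approx r'\lor r\approx r')\sigma\cdot\theta)$, where $s\theta=r\theta$, $\sigma=\mathrm{mgu}(s\doteq r)$, $s\theta\succ s'\theta$, and $(s\approx s')\theta$ is maximal in $(C'\lor r\approx r'\lor s\approx s')\theta$. Non-Horn ordering: $\mathrm{ss}^-(C)$ set of all subterms (including top) of sides of negative literals of $C$; $\mathrm{ts}^-(C)$ set of sides of negative literals. $\mathrm{rm}_R(t)=\emptyset$ if $t$ is $R$-irreducible, $\mathrm{rm}_R(t)=\{\{u,u\}\}\cup\mathrm{rm}_R(t')$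 if $t\to_Rt'$ using $u\to v\in R$. $\mathrm{nm}_R(C\cdot\theta)=\bigcup_{f(t_1,\dots,t_n)\in\mathrm{ss}^-(C)}\mathrm{rm}_R(f(t_1\theta{\downarrow}_R,\dots,t_n\theta{\downarrow}_R))\cup\bigcup_{x\in\mathrm{ss}^-(C),x\text{ variable}}\mathrm{rm}_R(x\theta)\cup\bigcup_{t\in\mathrm{ts}^-(C)}\{\{t\theta{\downarrow}_R,t\theta{\downarrow}_R\}\}\cup\bigcup_{(s\approx s')\in C}\{\{s\theta,s'\theta\}\}$ (multiset unions; last union over positive literals of $C$). Fix a well-founded $\succ_{Clo}$ on ground closures, total on closures with equal ground instance, with $(C\cdot\theta_1)\succ_{Clo}(D\cdot\theta_2)$ whenever $C\theta_1=D\theta_2$ and $D$ is an instance of $C$ but not vice versa. $\succ\!\!\succ_R$: lexicographic combination of (1) $(\succ_{mul})_{mul}$ on $\mathrm{nm}_R$, (2) $\succ_C$ on ground instances, (3) $\succ_{Clo}$. -}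

module Defs where

open import Data.Nat using (ℕ)
open import Data.Empty using (⊥)
open import Data.Unit using (⊤)
open import Data.Product using (Σ; ∃; _×_; _,_)
open import Data.Sum using (_⊎_)
open import Data.List using (List; []; _∷_; _++_; map; concat)
open import Data.List.Relation.Unary.All using (All)
open import Data.List.Relation.Unary.Any using (Any)
open import Data.List.Relation.Binary.Pointwise using (Pointwise)
open import Data.List.Relation.Binary.Permutation.Propositional using (_↭_)
open import Data.List.Relation.Unary.Unique.Propositional using (Unique)
import Data.List.Membership.Propositional as LM
open import Data.Vec using (Vec; []; _∷_)
import Data.Vec.Membership.Propositional as VM
import Data.Vec.Relation.Binary.Pointwise.Inductive as VP
open import Relation.Nullary using (¬_)
open import Relation.Binary.PropositionalEquality using (_≡_; _≢_)
open import Induction.WellFounded using (WellFounded)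
open import Function.Bundles using (_⇔_)

record Signature : Set₁ where
  field
    Sym   : Set
    arity : Sym → ℕ

open Signature public

data Term (sig : Signature) : Set where
  var : ℕ → Term sig
  fun : (f : Sym sig) → Vec (Term sig) (arity sig f) → Term sig

Subst : Signature → Set
Subst sig = ℕ → Term sig

module _ {sig : Signature} where

  infixl 30 _⟨_⟩ _⟨_⟩*

  _⟨_⟩ : Term sig → Subst sig → Term sig
  _⟨_⟩* : ∀ {n} → Vec (Term sig) n → Subst sig → Vec (Term sig) n
  var x ⟨ σ ⟩ = σ x
  fun f ts ⟨ σ ⟩ = fun f (ts ⟨ σ ⟩*)
  [] ⟨ σ ⟩* = []
  (t ∷ ts) ⟨ σ ⟩* = t ⟨ σ ⟩ ∷ ts ⟨ σ ⟩*

  Ground : Term sig → Set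
  Ground* : ∀ {n} → Vec (Term sig) n → Set
  Ground (var x) = ⊥
  Ground (fun f ts) = Ground* ts
  Ground* [] = ⊤
  Ground* (t ∷ ts) = Ground t × Ground* ts

  data _⊴_ (u : Term sig) : Term sig → Set where
    here  : u ⊴ u
    below : ∀ {f ts t} → t VM.∈ ts → u ⊴ t → u ⊴ fun f ts

data OneArg {A : Set} (P : A → A → Set) : ∀ {n} → Vec A n → Vec A n → Set where
  here  : ∀ {n x y} {xs : Vec A n} → P x y → OneArg P (x ∷ xs) (y ∷ xs)
  there : ∀ {n x} {xs ys : Vec A n} → OneArg P xs ys → OneArg P (x ∷ xs) (x ∷ ys)

record ReductionOrdering (sig : Signature) : Set₁ where
  field
    _≻_      : Term sig → Term sig → Set
    irrefl   : ∀ t → ¬ (t ≻ t)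
    trans    : ∀ {s t u} → s ≻ t → t ≻ u → s ≻ u
    wf       : WellFounded (λ s t → t ≻ s)
    stable   : ∀ {s t} (σ : Subst sig) → s ≻ t → (s ⟨ σ ⟩) ≻ (t ⟨ σ ⟩)
    monotone : ∀ (f : Sym sig) {ts ts'} → OneArg _≻_ ts ts' → fun f ts ≻ fun f ts'
    total    : ∀ {s t} → Ground s → Ground t → s ≡ t ⊎ (s ≻ t ⊎ t ≻ s)

-- Multisets (as lists up to permutation) and the multiset extension
-- (Dershowitz–Manna), relative to an element equivalence _≈_

MSEq : {A : Set} → (A → A → Set) → List A → List A → Set
MSEq _≈_ M N = ∃ λ Z → (M ↭ Z) × Pointwise _≈_ Z N

MulExt : {A : Set} → (A → A → Set) → (A → A → Set) → List A → List A → Set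
MulExt _≈_ _>_ M N =
  ∃ λ Z₁ → ∃ λ Z₂ → ∃ λ X → ∃ λ Y →
    (M ↭ Z₁ ++ X) × (N ↭ Z₂ ++ Y) × Pointwise _≈_ Z₁ Z₂ × (X ≢ []) ×
    All (λ y → Any (λ x → x > y) X) Y

data Lit (sig : Signature) : Set where
  pos : Term sig → Term sig → Lit sig
  neg : Term sig → Term sig → Lit sig

Clause : Signature → Set
Clause sig = List (Lit sig)

module _ {sig : Signature} where

  infixl 30 _⟨_⟩ˡ _⟨_⟩ᶜ
  _⟨_⟩ˡ : Lit sig → Subst sig → Lit sig
  pos s t ⟨ σ ⟩ˡ = pos (s ⟨ σ ⟩) (t ⟨ σ ⟩)
  neg s t ⟨ σ ⟩ˡ = neg (s ⟨ σ ⟩) (t ⟨ σ ⟩)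

  _⟨_⟩ᶜ : Clause sig → Subst sig → Clause sig
  C ⟨ σ ⟩ᶜ = map (λ L → L ⟨ σ ⟩ˡ) C

  GroundLit : Lit sig → Set
  GroundLit (pos s t) = Ground s × Ground t
  GroundLit (neg s t) = Ground s × Ground t

  GroundClause : Clause sig → Set
  GroundClause C = All GroundLit C

  -- the multiset of terms ≻_L associates with a literal
  litMS : Lit sig → List (Term sig)
  litMS (pos s t) = s ∷ t ∷ []
  litMS (neg s t) = s ∷ s ∷ t ∷ t ∷ []

  -- equality of clauses as multisets of literals, ≈ symmetric
  ClauseEq : Clause sig → Clause sig → Set
  ClauseEq C D = MSEq _↭_ (map litMS C) (map litMS D)

module Orders {sig : Signature} (O : ReductionOrdering sig) where
  open ReductionOrdering O

  _≻ₘ_ : List (Term sig) → List (Term sig) → Set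
  _≻ₘ_ = MulExt _≡_ _≻_

  _≻ₘₘ_ : List (List (Term sig)) → List (List (Term sig)) → Set
  _≻ₘₘ_ = MulExt _↭_ _≻ₘ_

  _≻L_ : Lit sig → Lit sig → Set
  L ≻L L' = litMS L ≻ₘ litMS L'

  _≻C_ : Clause sig → Clause sig → Set
  C ≻C D = map litMS C ≻ₘₘ map litMS D

  Maximal : Lit sig → Clause sig → Set
  Maximal L C = ∀ {L'} → L' LM.∈ C → ¬ (L' ≻L L)

RewriteSystem : Signature → Set₁
RewriteSystem sig = Term sig → Term sig → Set

module _ {sig : Signature} where

  data StepAt (u v : Term sig) : Term sig → Term sig → Set where
    root : StepAt u v u v
    arg  : ∀ (f : Sym sig) {ts ts'} → OneArg (StepAt u v) ts ts' →
           StepAt u v (fun f ts) (fun f ts')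

  ReducibleBy : Term sig → Term sig → Term sig → Set
  ReducibleBy u v t = ∃ λ t' → StepAt u v t t'

  Irreducible : RewriteSystem sig → Term sig → Set
  Irreducible R t = ∀ {u v} → R u v → ¬ ReducibleBy u v t

  ContainedIn : ReductionOrdering sig → RewriteSystem sig → Set
  ContainedIn O R = ∀ {u v} → R u v →
    Ground u × Ground v × ReductionOrdering._≻_ O u v

  LeftReduced : RewriteSystem sig → Set
  LeftReduced R = ∀ {u v u' v'} → R u v → R u' v' →
    (u' , v') ≢ (u , v) → ¬ ReducibleBy u' v' u

  data NF (R : RewriteSystem sig) : Term sig → Term sig → Set where
    done : ∀ {t} → Irreducible R t → NF R t t
    step : ∀ {u v t t₁ t₂} → R u v → StepAt u v t t₁ → NF R t₁ t₂ → NF R t t₂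

  data RM (R : RewriteSystem sig) : Term sig → List (List (Term sig)) → Set where
    done : ∀ {t} → Irreducible R t → RM R t []
    step : ∀ {u v t t' M} → R u v → StepAt u v t t' → RM R t' M →
           RM R t ((u ∷ u ∷ []) ∷ M)

  InTS⁻ : Clause sig → Term sig → Set
  InTS⁻ C u = ∃ λ s → ∃ λ t → (neg s t LM.∈ C) × (u ≡ s ⊎ u ≡ t)

  InSS⁻ : Clause sig → Term sig → Set
  InSS⁻ C u = ∃ λ t → InTS⁻ C t × u ⊴ t

  Enumerates : (Term sig → Set) → List (Term sig) → Set
  Enumerates P S = Unique S × (∀ u → (u LM.∈ S) ⇔ P u)

  data SSPiece (R : RewriteSystem sig) (θ : Subst sig) :
                Term sig → List (List (Term sig)) → Set where
    varP : ∀ {x M} → RM R (θ x) M → SSPiece R θ (var x) M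
    funP : ∀ {f ts ts' M} → VP.Pointwise (NF R) (ts ⟨ θ ⟩*) ts' →
           RM R (fun f ts') M → SSPiece R θ (fun f ts) M

  posPairs : Clause sig → Subst sig → List (List (Term sig))
  posPairs [] θ = []
  posPairs (pos s s' ∷ C) θ = (s ⟨ θ ⟩ ∷ s' ⟨ θ ⟩ ∷ []) ∷ posPairs C θ
  posPairs (neg s s' ∷ C) θ = posPairs C θ

  dbl : Term sig → List (Term sig)
  dbl t = t ∷ t ∷ []

  NM : RewriteSystem sig → Clause sig → Subst sig → List (List (Term sig)) → Set
  NM R C θ N =
    ∃ λ S₁ → ∃ λ Ms → ∃ λ S₂ → ∃ λ S₂' →
      Enumerates (InSS⁻ C) S₁ × Pointwise (SSPiece R θ) S₁ Ms ×
      Enumerates (InTS⁻ C) S₂ × Pointwise (λ t t' → NF R (t ⟨ θ ⟩) t') S₂ S₂' ×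
      (N ↭ (concat Ms ++ map dbl S₂' ++ posPairs C θ))

Closure : Signature → Set
Closure sig = Clause sig × Subst sig

module _ {sig : Signature} where

  inst : Closure sig → Clause sig
  inst (C , θ) = C ⟨ θ ⟩ᶜ

  GroundClosure : Closure sig → Set
  GroundClosure c = GroundClause (inst c)

  ClosEq : Closure sig → Closure sig → Set
  ClosEq (C₁ , θ₁) (C₂ , θ₂) =
    ∃ λ (ρ : ℕ → ℕ) → ∃ λ (ρ⁻ : ℕ → ℕ) →
      (∀ x → ρ⁻ (ρ x) ≡ x) × (∀ x → ρ (ρ⁻ x) ≡ x) ×
      ClauseEq C₂ (C₁ ⟨ (λ x → var (ρ x)) ⟩ᶜ) ×
      ClauseEq (C₁ ⟨ θ₁ ⟩ᶜ) (C₂ ⟨ θ₂ ⟩ᶜ)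

  InstanceOf : Clause sig → Clause sig → Set
  InstanceOf D C = ∃ λ σ → ClauseEq D (C ⟨ σ ⟩ᶜ)

  record IsClosureOrder (_≻Clo_ : Closure sig → Closure sig → Set) : Set where
    field
      trans    : ∀ {a b c} → a ≻Clo b → b ≻Clo c → a ≻Clo c
      wf       : WellFounded (λ a b → b ≻Clo a)
      respects : ∀ {a a' b b'} → ClosEq a a' → ClosEq b b' → a ≻Clo b → a' ≻Clo b'
      total    : ∀ {a b} → GroundClosure a → GroundClosure b →
                 ClauseEq (inst a) (inst b) → ClosEq a b ⊎ (a ≻Clo b ⊎ b ≻Clo a)
      instance-larger : ∀ {C θ₁ D θ₂} → ClauseEq (C ⟨ θ₁ ⟩ᶜ) (D ⟨ θ₂ ⟩ᶜ) →
                 InstanceOf D C → ¬ InstanceOf C D → (C , θ₁) ≻Clo (D , θ₂)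

-- The non-Horn R-normalization closure ordering ≻≻_R
-- (lexicographic: nm_R under (≻_mul)_mul, then ≻_C on ground instances,
--  then ≻_Clo).  nm_R is given relationally; the comparison is required
--  for all computations of nm_R.

module NonHorn {sig : Signature} (O : ReductionOrdering sig) (R : RewriteSystem sig)
               (_≻Clo_ : Closure sig → Closure sig → Set) where
  open Orders O

  _≻≻_ : Closure sig → Closure sig → Set
  (C , θ₁) ≻≻ (D , θ₂) =
    ∀ {N₁ N₂} → NM R C θ₁ N₁ → NM R D θ₂ N₂ →
      N₁ ≻ₘₘ N₂ ⊎
      (MSEq _↭_ N₁ N₂ ×
        ((C ⟨ θ₁ ⟩ᶜ) ≻C (D ⟨ θ₂ ⟩ᶜ) ⊎
         (ClauseEq (C ⟨ θ₁ ⟩ᶜ) (D ⟨ θ₂ ⟩ᶜ) × (C , θ₁) ≻Clo (D , θ₂))))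

module _ {sig : Signature} where

  Unifier : Subst sig → Term sig → Term sig → Set
  Unifier σ s r = s ⟨ σ ⟩ ≡ r ⟨ σ ⟩

  IsIdempotentMGU : Subst sig → Term sig → Term sig → Set
  IsIdempotentMGU σ s r =
    Unifier σ s r ×
    (∀ τ → Unifier τ s r → ∃ λ ρ → ∀ x → τ x ≡ (σ x) ⟨ ρ ⟩) ×
    (∀ x → (σ x) ⟨ σ ⟩ ≡ σ x)

module _ {sig : Signature} (O : ReductionOrdering sig) where
  open ReductionOrdering O
  open Orders O

  record GroundEqFactoring (prem concl : Closure sig) : Set where
    field
      C'   : Clause sig
      r r' s s' : Term sig
      θ σ  : Subst sig
      prem≡  : prem ≡ ((C' ++ pos r r' ∷ pos s s' ∷ []) , θ)
      concl≡ : concl ≡ (((C' ++ neg s' r' ∷ pos r r' ∷ []) ⟨ σ ⟩ᶜ) , θ)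
      ground : GroundClosure prem
      sθ≡rθ  : s ⟨ θ ⟩ ≡ r ⟨ θ ⟩
      mgu    : IsIdempotentMGU σ s r
      sθ≻s'θ : s ⟨ θ ⟩ ≻ s' ⟨ θ ⟩
      maximal : Maximal (pos s s' ⟨ θ ⟩ˡ) (inst prem)

{-# OPTIONS --safe #-}

-- Since θ unifies s and r and σ is an idempotent mgu, σθ = θ, so premise and
-- conclusion share the ground instances of C' and of r ≈ r'.  A term of ss⁻(C'σ)
-- is either uσ for a non-variable u ∈ ss⁻(C'), contributing exactly what u does,
-- or a subterm of xσ for a variable x ∈ ss⁻(C'); and since R is left-reduced
-- (so rewriting is confluent and rm_R is determined up to permutation), rm_R(xθ)
-- splits into the contributions of all subterms of xσ.  Likewise ts⁻(C'σ) is the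
-- σ-image of ts⁻(C').  What remains of nm_R of the conclusion comes from the new
-- literal s'σ ≉ r'σ, whose terms lie below s'θ or r'θ and hence below sθ (for r'θ
-- by maximality of sθ ≈ s'θ, as rθ = sθ); so it is dominated by the pair
-- {sθ, s'θ}, which only the premise contains.

module Submission where

open import Defs
open import Data.Empty using (⊥-elim)
open import Data.Fin using (Fin; zero; suc)
open import Data.Nat using (ℕ; suc; _+_; _≤_; _<_; s≤s)
open import Data.Nat.Properties using (≤-refl; ≤-trans; m≤m+n; m≤n+m; n≤1+n; <-irrefl)
open import Data.Product using (Σ; ∃; ∃₂; _×_; _,_; proj₁; proj₂)
open import Data.Sum using (_⊎_; inj₁; inj₂)
import Data.Sum as Sum
open import Data.List using (List; []; _∷_; _++_; [_]; map; concat; concatMap)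
open import Data.List.Properties using (++-assoc; ++-identityʳ; concat-++; concat-map-[_])
open import Data.List.Relation.Unary.All using (All; []; _∷_)
import Data.List.Relation.Unary.All as All
import Data.List.Relation.Unary.All.Properties as Allₚ
open import Data.List.Relation.Unary.Any using (here; there)
open import Data.List.Relation.Unary.AllPairs using ([]; _∷_)
open import Data.List.Relation.Unary.Unique.Propositional using (Unique)
open import Data.List.Relation.Binary.Pointwise using (Pointwise; []; _∷_)
import Data.List.Relation.Binary.Pointwise as Pointwise
open import Data.List.Relation.Binary.Permutation.Propositional
  using (_↭_; prep; swap; ↭-refl; ↭-sym; ↭-trans; ↭-reflexive; module PermutationReasoning)
open import Data.List.Relation.Binary.Permutation.Propositional.Properties
  using (++⁺ˡ; ++⁺; shift; shifts; ∷↭∷ʳ)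
open import Data.List.Membership.Propositional using (_∈_)
open import Data.List.Membership.Propositional.Properties
  using (∈-map⁺; ∈-map⁻; ∈-++⁺ˡ; ∈-++⁺ʳ; ∈-++⁻; ∈-concat⁺′)
open import Data.Vec using (Vec; []; _∷_; toList; _[_]≔_)
open import Data.Vec.Properties using ([]≔-lookup)
open import Data.Vec.Membership.Propositional using () renaming (_∈_ to _∈ᵥ_)
import Data.Vec.Relation.Unary.Any as VAny
open import Data.Vec.Relation.Unary.Any.Properties using (lookup-index)
import Data.Vec.Relation.Binary.Pointwise.Inductive as VP
open import Function using (_∘_; id)
open import Function.Bundles using (Equivalence)
open import Induction.WellFounded using (Acc; acc)
open import Relation.Binary.PropositionalEquality
  using (_≡_; _≢_; _≗_; refl; sym; trans; cong; cong₂; subst; subst₂; module ≡-Reasoning)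
open import Relation.Nullary using (¬_; Dec; yes; no)

-- Terms and substitutions

module _ {sig : Signature} where

  private variable
    n : ℕ
    f : Sym sig
    s t t' u v w : Term sig
    ts ts' : Vec (Term sig) n
    σ θ : Subst sig

  _⨾_ : Subst sig → Subst sig → Subst sig
  (σ ⨾ ρ) x = σ x ⟨ ρ ⟩

  ⟨⟩-cong : ∀ {σ τ : Subst sig} → σ ≗ τ → ∀ t → t ⟨ σ ⟩ ≡ t ⟨ τ ⟩
  ⟨⟩*-cong : ∀ {σ τ : Subst sig} → σ ≗ τ → (ts : Vec (Term sig) n) → ts ⟨ σ ⟩* ≡ ts ⟨ τ ⟩*
  ⟨⟩-cong σ≗τ (var x) = σ≗τ x
  ⟨⟩-cong σ≗τ (fun f ts) = cong (fun f) (⟨⟩*-cong σ≗τ ts)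
  ⟨⟩*-cong σ≗τ [] = refl
  ⟨⟩*-cong σ≗τ (t ∷ ts) = cong₂ _∷_ (⟨⟩-cong σ≗τ t) (⟨⟩*-cong σ≗τ ts)

  ⟨⟩-⨾ : ∀ (σ ρ : Subst sig) t → t ⟨ σ ⟩ ⟨ ρ ⟩ ≡ t ⟨ σ ⨾ ρ ⟩
  ⟨⟩*-⨾ : ∀ (σ ρ : Subst sig) (ts : Vec (Term sig) n) → ts ⟨ σ ⟩* ⟨ ρ ⟩* ≡ ts ⟨ σ ⨾ ρ ⟩*
  ⟨⟩-⨾ σ ρ (var x) = refl
  ⟨⟩-⨾ σ ρ (fun f ts) = cong (fun f) (⟨⟩*-⨾ σ ρ ts)
  ⟨⟩*-⨾ σ ρ [] = refl
  ⟨⟩*-⨾ σ ρ (t ∷ ts) = cong₂ _∷_ (⟨⟩-⨾ σ ρ t) (⟨⟩*-⨾ σ ρ ts)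

  ⟨⟩-absorb : σ ⨾ θ ≗ θ → ∀ t → t ⟨ σ ⟩ ⟨ θ ⟩ ≡ t ⟨ θ ⟩
  ⟨⟩-absorb {σ} {θ} σ⨾θ≗θ t = trans (⟨⟩-⨾ σ θ t) (⟨⟩-cong σ⨾θ≗θ t)

  ⟨⟩*-absorb : σ ⨾ θ ≗ θ → (ts : Vec (Term sig) n) → ts ⟨ σ ⟩* ⟨ θ ⟩* ≡ ts ⟨ θ ⟩*
  ⟨⟩*-absorb {σ} {θ} σ⨾θ≗θ ts = trans (⟨⟩*-⨾ σ θ ts) (⟨⟩*-cong σ⨾θ≗θ ts)

  idempotent-mgu-absorbed : IsIdempotentMGU σ s t → Unifier θ s t → σ ⨾ θ ≗ θ
  idempotent-mgu-absorbed {σ} {θ = θ} (_ , most-general , idempotent) θ-unifies x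
    with most-general θ θ-unifies
  ... | ρ , θ≗σ⨾ρ = begin
    σ x ⟨ θ ⟩        ≡⟨ ⟨⟩-cong θ≗σ⨾ρ (σ x) ⟩
    σ x ⟨ σ ⨾ ρ ⟩    ≡⟨ ⟨⟩-⨾ σ ρ (σ x) ⟨
    σ x ⟨ σ ⟩ ⟨ ρ ⟩  ≡⟨ cong _⟨ ρ ⟩ (idempotent x) ⟩
    σ x ⟨ ρ ⟩        ≡⟨ θ≗σ⨾ρ x ⟨
    θ x              ∎
    where open ≡-Reasoning

  size : Term sig → ℕ
  size* : Vec (Term sig) n → ℕ
  size (var x) = 1
  size (fun f ts) = suc (size* ts)
  size* [] = 0
  size* (t ∷ ts) = size t + size* ts

  ∈ᵥ⇒size≤size* : t ∈ᵥ ts → size t ≤ size* ts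
  ∈ᵥ⇒size≤size* {ts = t ∷ ts} (VAny.here refl) = m≤m+n (size t) (size* ts)
  ∈ᵥ⇒size≤size* {ts = t ∷ ts} (VAny.there t∈ts) =
    ≤-trans (∈ᵥ⇒size≤size* t∈ts) (m≤n+m (size* ts) (size t))

  ⊴⇒size≤ : u ⊴ t → size u ≤ size t
  ⊴⇒size≤ here = ≤-refl
  ⊴⇒size≤ (below t∈ts u⊴t) = ≤-trans (⊴⇒size≤ u⊴t) (≤-trans (∈ᵥ⇒size≤size* t∈ts) (n≤1+n _))

  StepAt⇒⊴ : StepAt u v t t' → u ⊴ t
  OneArg-StepAt⇒⊴ : OneArg (StepAt u v) ts ts' → ∃ λ t → t ∈ᵥ ts × u ⊴ t
  StepAt⇒⊴ root = here
  StepAt⇒⊴ (arg f st) with OneArg-StepAt⇒⊴ st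
  ... | t , t∈ts , u⊴t = below t∈ts u⊴t
  OneArg-StepAt⇒⊴ (here st) = _ , VAny.here refl , StepAt⇒⊴ st
  OneArg-StepAt⇒⊴ (there st) with OneArg-StepAt⇒⊴ st
  ... | t , t∈ts , u⊴t = t , VAny.there t∈ts , u⊴t

  inner-redex-smaller : OneArg (StepAt u v) ts ts' → size u < size (fun f ts)
  inner-redex-smaller st with OneArg-StepAt⇒⊴ st
  ... | t , t∈ts , u⊴t = s≤s (≤-trans (⊴⇒size≤ u⊴t) (∈ᵥ⇒size≤size* t∈ts))

  subterms : Term sig → List (Term sig)
  subterms* : Vec (Term sig) n → List (Term sig)
  subterms (var x) = [ var x ]
  subterms (fun f ts) = fun f ts ∷ subterms* ts
  subterms* [] = []
  subterms* (t ∷ ts) = subterms t ++ subterms* ts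

  ⊴⇒∈subterms : w ⊴ t → w ∈ subterms t
  ∈ᵥ⇒∈subterms* : t ∈ᵥ ts → w ∈ subterms t → w ∈ subterms* ts
  ⊴⇒∈subterms {t = var x} here = here refl
  ⊴⇒∈subterms {t = fun f ts} here = here refl
  ⊴⇒∈subterms (below t∈ts w⊴t) = there (∈ᵥ⇒∈subterms* t∈ts (⊴⇒∈subterms w⊴t))
  ∈ᵥ⇒∈subterms* {ts = t ∷ ts} (VAny.here refl) w∈t = ∈-++⁺ˡ w∈t
  ∈ᵥ⇒∈subterms* {ts = t ∷ ts} (VAny.there t∈ts) w∈t = ∈-++⁺ʳ (subterms t) (∈ᵥ⇒∈subterms* t∈ts w∈t)

  ∈ᵥ-⟨⟩*⁺ : t ∈ᵥ ts → t ⟨ θ ⟩ ∈ᵥ ts ⟨ θ ⟩*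
  ∈ᵥ-⟨⟩*⁺ {ts = t ∷ ts} (VAny.here refl) = VAny.here refl
  ∈ᵥ-⟨⟩*⁺ {ts = t ∷ ts} (VAny.there t∈ts) = VAny.there (∈ᵥ-⟨⟩*⁺ t∈ts)

  ∈ᵥ-⟨⟩*⁻ : (ts : Vec (Term sig) n) → u ∈ᵥ ts ⟨ θ ⟩* → ∃ λ t → t ∈ᵥ ts × u ≡ t ⟨ θ ⟩
  ∈ᵥ-⟨⟩*⁻ (t ∷ ts) (VAny.here refl) = t , VAny.here refl , refl
  ∈ᵥ-⟨⟩*⁻ (t ∷ ts) (VAny.there u∈ts) with ∈ᵥ-⟨⟩*⁻ ts u∈ts
  ... | t' , t'∈ts , eq = t' , VAny.there t'∈ts , eq

  ⊴-⟨⟩ : ∀ θ → u ⊴ t → u ⟨ θ ⟩ ⊴ t ⟨ θ ⟩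
  ⊴-⟨⟩ θ here = here
  ⊴-⟨⟩ θ (below t∈ts u⊴t) = below (∈ᵥ-⟨⟩*⁺ t∈ts) (⊴-⟨⟩ θ u⊴t)

  ⊴-⟨⟩⁻ : ∀ t → w ⊴ t ⟨ σ ⟩ →
          (∃₂ λ f ts → fun f ts ⊴ t × w ≡ fun f ts ⟨ σ ⟩) ⊎ (∃ λ x → var x ⊴ t × w ⊴ σ x)
  ⊴-⟨⟩⁻ (var x) w⊴σx = inj₂ (x , here , w⊴σx)
  ⊴-⟨⟩⁻ (fun f ts) here = inj₁ (f , ts , here , refl)
  ⊴-⟨⟩⁻ (fun f ts) (below u∈tsσ w⊴u) with ∈ᵥ-⟨⟩*⁻ ts u∈tsσ
  ... | t , t∈ts , refl with ⊴-⟨⟩⁻ t w⊴u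
  ...   | inj₁ (g , us , g-us⊴t , eq) = inj₁ (g , us , below t∈ts g-us⊴t , eq)
  ...   | inj₂ (x , x⊴t , w⊴σx) = inj₂ (x , below t∈ts x⊴t , w⊴σx)

  Ground-∈ᵥ : t ∈ᵥ ts → Ground* ts → Ground t
  Ground-∈ᵥ {ts = _ ∷ _} (VAny.here refl) (ground , _) = ground
  Ground-∈ᵥ {ts = _ ∷ _} (VAny.there t∈ts) (_ , ground) = Ground-∈ᵥ t∈ts ground

  Ground-⊴ : u ⊴ t → Ground t → Ground u
  Ground-⊴ here ground = ground
  Ground-⊴ (below t∈ts u⊴t) ground = Ground-⊴ u⊴t (Ground-∈ᵥ t∈ts ground)

-- Reduction orderings

OneArg-[]≔ : ∀ {A : Set} {P : A → A → Set} {n} (xs : Vec A n) (i : Fin n) {a b} →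
             P a b → OneArg P (xs [ i ]≔ a) (xs [ i ]≔ b)
OneArg-[]≔ (x ∷ xs) zero p = here p
OneArg-[]≔ (x ∷ xs) (suc i) p = there (OneArg-[]≔ xs i p)

module OrderingFacts {sig : Signature} (O : ReductionOrdering sig) where
  open ReductionOrdering O renaming (trans to ≻-trans)

  private variable
    n : ℕ
    a b c t t' u v : Term sig
    ts ts' : Vec (Term sig) n

  _⪰_ : Term sig → Term sig → Set
  a ⪰ b = a ≡ b ⊎ a ≻ b

  ⪰-trans : a ⪰ b → b ⪰ c → a ⪰ c
  ⪰-trans (inj₁ refl) b⪰c = b⪰c
  ⪰-trans (inj₂ a≻b) (inj₁ refl) = inj₂ a≻b
  ⪰-trans (inj₂ a≻b) (inj₂ b≻c) = inj₂ (≻-trans a≻b b≻c)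

  ≻-⪰-trans : a ≻ b → b ⪰ c → a ≻ c
  ≻-⪰-trans a≻b (inj₁ refl) = a≻b
  ≻-⪰-trans a≻b (inj₂ b≻c) = ≻-trans a≻b b≻c

  ground-≡-dec : Ground a → Ground b → Dec (a ≡ b)
  ground-≡-dec ga gb with total ga gb
  ... | inj₁ a≡b = yes a≡b
  ... | inj₂ (inj₁ a≻b) = no λ { refl → irrefl _ a≻b }
  ... | inj₂ (inj₂ b≻a) = no λ { refl → irrefl _ b≻a }

  StepAt-≻ : u ≻ v → StepAt u v t t' → t ≻ t'
  OneArg-StepAt-≻ : u ≻ v → OneArg (StepAt u v) ts ts' → OneArg _≻_ ts ts'
  StepAt-≻ u≻v root = u≻v
  StepAt-≻ u≻v (arg f st) = monotone f (OneArg-StepAt-≻ u≻v st)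
  OneArg-StepAt-≻ u≻v (here st) = here (StepAt-≻ u≻v st)
  OneArg-StepAt-≻ u≻v (there st) = there (OneArg-StepAt-≻ u≻v st)

  Pointwise-⪰-mono : (K : Vec (Term sig) n → Term sig) → (∀ {xs ys} → OneArg _≻_ xs ys → K xs ≻ K ys) →
                     ∀ {xs ys} → VP.Pointwise _⪰_ xs ys → K xs ⪰ K ys
  Pointwise-⪰-mono K mono VP.[] = inj₁ refl
  Pointwise-⪰-mono K mono (VP._∷_ {x = x} {y = y} {ys = ys} x⪰y xs⪰ys) =
    ⪰-trans (Pointwise-⪰-mono (λ zs → K (x ∷ zs)) (mono ∘ there) xs⪰ys) (head-⪰ x⪰y)
    where
    head-⪰ : x ⪰ y → K (x ∷ ys) ⪰ K (y ∷ ys)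
    head-⪰ (inj₁ refl) = inj₁ refl
    head-⪰ (inj₂ x≻y) = inj₂ (mono (here x≻y))

  Monotone : (Term sig → Term sig) → Set
  Monotone K = ∀ {a b} → a ≻ b → K a ≻ K b

  ⊴⇒context : u ⊴ t → Σ (Term sig → Term sig) λ K → Monotone K × K u ≡ t
  ⊴⇒context here = id , id , refl
  ⊴⇒context (below {f = f} {ts} {t} t∈ts u⊴t) with ⊴⇒context u⊴t
  ... | K , K-mono , Ku≡t =
    (λ a → fun f (ts [ i ]≔ K a)) ,
    (λ a≻b → monotone f (OneArg-[]≔ ts i (K-mono a≻b))) ,
    cong (fun f) (trans (cong (ts [ i ]≔_) (trans Ku≡t (lookup-index t∈ts))) ([]≔-lookup ts i))
    where
    i = VAny.index t∈ts

  monotone-no-ascent : ∀ {K} → Monotone K → ∀ a → ¬ (a ≻ K a)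
  monotone-no-ascent {K} K-mono a = go a (wf a)
    where
    go : ∀ a → Acc (λ s t → t ≻ s) a → ¬ (a ≻ K a)
    go a (acc rs) a≻Ka = go (K a) (rs a≻Ka) (K-mono a≻Ka)

  ⊴⇒⪰ : Ground t → u ⊴ t → t ⪰ u
  ⊴⇒⪰ ground u⊴t with total ground (Ground-⊴ u⊴t ground)
  ... | inj₁ t≡u = inj₁ t≡u
  ... | inj₂ (inj₁ t≻u) = inj₂ t≻u
  ... | inj₂ (inj₂ u≻t) with ⊴⇒context u⊴t
  ...   | K , K-mono , refl = ⊥-elim (monotone-no-ascent K-mono _ u≻t)

-- Multisets

infix 4 _⊑[_]_
_⊑[_]_ : {E : Set} → List E → (E → Set) → List E → Set
M ⊑[ P ] N = ∃₂ λ Z Y → ∃ λ K → M ↭ Z ++ Y × N ↭ Z ++ K × All P Y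

module _ {E : Set} {P : E → Set} where

  private variable
    M M' N N' : List E

  ++-interleave : (a b c d : List E) → (a ++ b) ++ (c ++ d) ↭ (a ++ c) ++ (b ++ d)
  ++-interleave a b c d = begin
    (a ++ b) ++ c ++ d  ≡⟨ ++-assoc a b _ ⟩
    a ++ b ++ c ++ d    ↭⟨ ++⁺ˡ a (shifts b c) ⟩
    a ++ c ++ b ++ d    ≡⟨ ++-assoc a c _ ⟨
    (a ++ c) ++ b ++ d  ∎
    where open PermutationReasoning

  ⊑-refl : M ⊑[ P ] M
  ⊑-refl {M} = M , [] , [] , ↭-reflexive (sym (++-identityʳ M)) , ↭-reflexive (sym (++-identityʳ M)) , []

  All⇒⊑ : All P M → M ⊑[ P ] N
  All⇒⊑ {M} {N} PM = [] , M , N , ↭-refl , ↭-refl , PM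

  ⊑-respˡ : M ↭ M' → M ⊑[ P ] N → M' ⊑[ P ] N
  ⊑-respˡ M↭M' (Z , Y , K , M↭ , N↭ , PY) = Z , Y , K , ↭-trans (↭-sym M↭M') M↭ , N↭ , PY

  ⊑-respʳ : N ↭ N' → M ⊑[ P ] N → M ⊑[ P ] N'
  ⊑-respʳ N↭N' (Z , Y , K , M↭ , N↭ , PY) = Z , Y , K , M↭ , ↭-trans (↭-sym N↭N') N↭ , PY

  ⊑-++ : M ⊑[ P ] N → M' ⊑[ P ] N' → M ++ M' ⊑[ P ] N ++ N'
  ⊑-++ (Z , Y , K , M↭ , N↭ , PY) (Z' , Y' , K' , M'↭ , N'↭ , PY') =
    Z ++ Z' , Y ++ Y' , K ++ K' ,
    ↭-trans (++⁺ M↭ M'↭) (++-interleave Z Y Z' Y') ,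
    ↭-trans (++⁺ N↭ N'↭) (++-interleave Z K Z' K') ,
    Allₚ.++⁺ PY PY'

module _ {A : Set} {_≈_ _>_ : A → A → Set} where

  private variable
    x : A
    M M' N : List A

  MulExt-respˡ-↭ : M ↭ M' → MulExt _≈_ _>_ M N → MulExt _≈_ _>_ M' N
  MulExt-respˡ-↭ M↭M' (Z₁ , Z₂ , X , Y , M↭ , rest) = Z₁ , Z₂ , X , Y , ↭-trans (↭-sym M↭M') M↭ , rest

  ⊑⇒MulExt : (∀ {a} → a ≈ a) → N ⊑[ x >_ ] M → MulExt _≈_ _>_ (x ∷ M) N
  ⊑⇒MulExt {x = x} ≈-refl (Z , Y , K , N↭ , M↭ , x>Y) =
    Z , Z , x ∷ K , Y , ↭-trans (prep x M↭) (↭-sym (shift x Z K)) , N↭ ,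
    Pointwise.refl ≈-refl , (λ ()) , All.map here x>Y

module Pieces {A E : Set} (Piece : A → List E → Set)
              (Piece-unique : ∀ {a m m'} → Piece a m → Piece a m' → m ↭ m')
              (Negligible : A → Set) (P : E → Set)
              (negligible-pieces : ∀ {a m} → Negligible a → Piece a m → All P m) where

  private variable
    w : A
    S L : List A
    Ms Ls : List (List E)

  private
    Removal : List A → List (List E) → A → Set
    Removal L Ls w =
      ∃₂ λ L' Ls' → ∃ λ m → Pointwise Piece L' Ls' × Piece w m × concat Ls ↭ m ++ concat Ls' ×
        (∀ {a} → a ∈ L → w ≢ a → a ∈ L')

    remove : Pointwise Piece L Ls → w ∈ L → Removal L Ls w
    remove {L = w ∷ L} (q ∷ qs) (here refl) = L , _ , _ , qs , q , ↭-refl , keep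
      where
      keep : ∀ {a} → a ∈ w ∷ L → w ≢ a → a ∈ L
      keep (here refl) w≢w = ⊥-elim (w≢w refl)
      keep (there a∈L) _ = a∈L
    remove {L = b ∷ L} {w = w} (_∷_ {y = m} q qs) (there w∈L) with remove qs w∈L
    ... | L' , Ls' , m' , qs' , q-w , Ls↭ , keep =
      b ∷ L' , m ∷ Ls' , m' , q ∷ qs' , q-w , ↭-trans (++⁺ˡ m Ls↭) (shifts m m') , keep'
      where
      keep' : ∀ {a} → a ∈ b ∷ L → w ≢ a → a ∈ b ∷ L'
      keep' (here refl) _ = here refl
      keep' (there a∈L) w≢a = there (keep a∈L w≢a)

  concat-⊑ : Unique S → Pointwise Piece S Ms → Pointwise Piece L Ls →
             (∀ {w} → w ∈ S → w ∈ L ⊎ Negligible w) →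
             concat Ms ⊑[ P ] concat Ls
  concat-⊑ [] [] _ _ = All⇒⊑ []
  concat-⊑ {S = w ∷ S} (w≢S ∷ S-unique) (q ∷ qs) qs-L classify with classify (here refl)
  ... | inj₂ negligible =
    ⊑-++ (All⇒⊑ {N = []} (negligible-pieces negligible q)) (concat-⊑ S-unique qs qs-L (classify ∘ there))
  ... | inj₁ w∈L with remove qs-L w∈L
  ...   | L' , Ls' , m' , qs-L' , q-w , Ls↭ , keep =
    ⊑-respʳ (↭-sym Ls↭)
      (⊑-++ (⊑-respʳ (Piece-unique q q-w) ⊑-refl) (concat-⊑ S-unique qs qs-L' classify'))
    where
    classify' : ∀ {a} → a ∈ S → a ∈ L' ⊎ Negligible a
    classify' a∈S = Sum.map₁ (λ a∈L → keep a∈L (All.lookup w≢S a∈S)) (classify (there a∈S))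

-- Left-reduced ground rewrite systems

module GroundRewriting {sig : Signature} (O : ReductionOrdering sig) (R : RewriteSystem sig)
                       (R⊆≻ : ContainedIn O R) (R-left-reduced : LeftReduced R) where
  open ReductionOrdering O renaming (trans to ≻-trans)
  open OrderingFacts O

  private variable
    n : ℕ
    f : Sym sig
    t t' t₁ t₂ u u' v v' w nf : Term sig
    ts ts' ts₁ ts₂ nfs : Vec (Term sig) n
    ws ws' : List (Term sig)
    M M' : List (List (Term sig))
    θ : Subst sig

  private
    Bag : Set
    Bag = List (List (Term sig))

  rule-≻ : R u v → u ≻ v
  rule-≻ r = proj₂ (proj₂ (R⊆≻ r))

  rhs-ground : R u v → Ground v
  rhs-ground r = proj₁ (proj₂ (R⊆≻ r))

  StepAt-Ground : R u v → StepAt u v t t' → Ground t → Ground t'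
  OneArg-StepAt-Ground : R u v → OneArg (StepAt u v) ts ts' → Ground* ts → Ground* ts'
  StepAt-Ground r root _ = rhs-ground r
  StepAt-Ground r (arg f st) ground = OneArg-StepAt-Ground r st ground
  OneArg-StepAt-Ground r (here st) (ground , grounds) = StepAt-Ground r st ground , grounds
  OneArg-StepAt-Ground r (there st) (ground , grounds) = ground , OneArg-StepAt-Ground r st grounds

  NF-Ground : NF R t nf → Ground t → Ground nf
  NF-Ground (done _) ground = ground
  NF-Ground (step r st t↓) ground = NF-Ground t↓ (StepAt-Ground r st ground)

  NF*-Ground : VP.Pointwise (NF R) ts nfs → Ground* ts → Ground* nfs
  NF*-Ground VP.[] grounds = grounds
  NF*-Ground (t↓ VP.∷ ts↓) (ground , grounds) = NF-Ground t↓ ground , NF*-Ground ts↓ grounds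

  NF⇒⪰ : NF R t nf → t ⪰ nf
  NF⇒⪰ (done _) = inj₁ refl
  NF⇒⪰ (step r st t↓) = inj₂ (≻-⪰-trans (StepAt-≻ (rule-≻ r) st) (NF⇒⪰ t↓))

  NF*-fun-⪰ : VP.Pointwise (NF R) ts nfs → fun f ts ⪰ fun f nfs
  NF*-fun-⪰ {f = f} ts↓ = Pointwise-⪰-mono (fun f) (monotone f) (VP.map NF⇒⪰ ts↓)

  RM-bounded : Ground t → RM R t M → All (All (t ⪰_)) M
  RM-bounded ground (done _) = []
  RM-bounded {t = t} ground (step {u = u} {t' = t'} r st rm) =
    (t⪰u ∷ t⪰u ∷ []) ∷ All.map (All.map t'⪰⇒t⪰) (RM-bounded (StepAt-Ground r st ground) rm)
    where
    t⪰u : t ⪰ u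
    t⪰u = ⊴⇒⪰ ground (StepAt⇒⊴ st)
    t'⪰⇒t⪰ : ∀ {y} → t' ⪰ y → t ⪰ y
    t'⪰⇒t⪰ t'⪰y = inj₂ (≻-⪰-trans (StepAt-≻ (rule-≻ r) st) t'⪰y)

  SSPiece-bounded : Ground (w ⟨ θ ⟩) → SSPiece R θ w M → All (All (w ⟨ θ ⟩ ⪰_)) M
  SSPiece-bounded ground (varP rm) = RM-bounded ground rm
  SSPiece-bounded ground (funP ts↓ rm) =
    All.map (All.map (⪰-trans (NF*-fun-⪰ ts↓))) (RM-bounded (NF*-Ground ts↓ ground) rm)

  lhs-args-irreducible : R (fun f ts) v → R u' v' → ¬ OneArg (StepAt u' v') ts ts'
  lhs-args-irreducible r r' st =
    R-left-reduced r r' (λ eq → <-irrefl (cong (size ∘ proj₁) eq) (inner-redex-smaller st))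
                        (_ , arg _ st)

  Joinable : {X : Set} → (Term sig → Term sig → X → X → Set) → (u v u' v' : Term sig) → X → X → Set
  Joinable Step u v u' v' x₁ x₂ =
    (u ≡ u' × v ≡ v' × x₁ ≡ x₂) ⊎ ∃ λ x₃ → Step u' v' x₁ x₃ × Step u v x₂ x₃

  -- A left-hand side contains no other redex, and two root steps use the same
  -- rule, so each peak is trivial or closes with one step on either side.
  StepAt-joinable : R u v → R u' v' → StepAt u v t t₁ → StepAt u' v' t t₂ →
                    Joinable StepAt u v u' v' t₁ t₂
  OneArg-joinable : R u v → R u' v' → OneArg (StepAt u v) ts ts₁ → OneArg (StepAt u' v') ts ts₂ →
                    Joinable (λ a b → OneArg (StepAt a b)) u v u' v' ts₁ ts₂
  StepAt-joinable {v = v} {v' = v'} r r' root root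
    with ground-≡-dec {v} {v'} (rhs-ground r) (rhs-ground r')
  ... | yes refl = inj₁ (refl , refl , refl)
  ... | no v≢v' = ⊥-elim (R-left-reduced r r' (λ eq → v≢v' (sym (cong proj₂ eq))) (_ , root))
  StepAt-joinable r r' root (arg f st) = ⊥-elim (lhs-args-irreducible r r' st)
  StepAt-joinable r r' (arg f st) root = ⊥-elim (lhs-args-irreducible r' r st)
  StepAt-joinable r r' (arg f st₁) (arg f st₂) with OneArg-joinable r r' st₁ st₂
  ... | inj₁ (refl , refl , refl) = inj₁ (refl , refl , refl)
  ... | inj₂ (ts₃ , st₁' , st₂') = inj₂ (fun f ts₃ , arg f st₁' , arg f st₂')
  OneArg-joinable r r' (here {xs = xs} st₁) (here st₂) with StepAt-joinable r r' st₁ st₂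
  ... | inj₁ (refl , refl , refl) = inj₁ (refl , refl , refl)
  ... | inj₂ (t₃ , st₁' , st₂') = inj₂ (t₃ ∷ xs , here st₁' , here st₂')
  OneArg-joinable r r' (here {y = y} st₁) (there {ys = ys} st₂) = inj₂ (y ∷ ys , there st₂ , here st₁)
  OneArg-joinable r r' (there {ys = ys} st₁) (here {y = y} st₂) = inj₂ (y ∷ ys , here st₂ , there st₁)
  OneArg-joinable r r' (there {x = x} st₁) (there st₂) with OneArg-joinable r r' st₁ st₂
  ... | inj₁ (refl , refl , refl) = inj₁ (refl , refl , refl)
  ... | inj₂ (ts₃ , st₁' , st₂') = inj₂ (x ∷ ts₃ , there st₁' , there st₂')

  NF-StepAt : NF R t nf → R u v → StepAt u v t t' → NF R t' nf
  NF-StepAt (done irreducible) r st = ⊥-elim (irreducible r (_ , st))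
  NF-StepAt (step r₁ st₁ t₁↓) r st with StepAt-joinable r₁ r st₁ st
  ... | inj₁ (refl , refl , refl) = t₁↓
  ... | inj₂ (t₃ , st₁' , st') = step r₁ st' (NF-StepAt t₁↓ r st₁')

  NF-unique : NF R t u → NF R t v → u ≡ v
  NF-unique (done _) (done _) = refl
  NF-unique (done irreducible) (step r st _) = ⊥-elim (irreducible r (_ , st))
  NF-unique (step r st t₁↓) t↓ = NF-unique t₁↓ (NF-StepAt t↓ r st)

  NF*-unique : VP.Pointwise (NF R) ts ts₁ → VP.Pointwise (NF R) ts ts₂ → ts₁ ≡ ts₂
  NF*-unique VP.[] VP.[] = refl
  NF*-unique (t↓ VP.∷ ts↓) (t↓' VP.∷ ts↓') = cong₂ _∷_ (NF-unique t↓ t↓') (NF*-unique ts↓ ts↓')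

  RM-StepAt : RM R t M → R u v → StepAt u v t t' → ∃ λ M' → RM R t' M' × M ↭ dbl u ∷ M'
  RM-StepAt (done irreducible) r st = ⊥-elim (irreducible r (_ , st))
  RM-StepAt (step r₁ st₁ rm) r st with StepAt-joinable r₁ r st₁ st
  ... | inj₁ (refl , refl , refl) = _ , rm , ↭-refl
  ... | inj₂ (t₃ , st₁' , st') with RM-StepAt rm r st₁'
  ...   | M₃ , rm₃ , M↭ = _ , step r₁ st' rm₃ , ↭-trans (prep _ M↭) (swap _ _ ↭-refl)

  RM-unique : RM R t M → RM R t M' → M ↭ M'
  RM-unique (done _) (done _) = ↭-refl
  RM-unique (done irreducible) (step r st _) = ⊥-elim (irreducible r (_ , st))
  RM-unique (step r st rm₁) rm with RM-StepAt rm r st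
  ... | M₀ , rm₀ , M'↭ = ↭-trans (prep _ (RM-unique rm₁ rm₀)) (↭-sym M'↭)

  SSPiece-unique : SSPiece R θ w M → SSPiece R θ w M' → M ↭ M'
  SSPiece-unique (varP rm) (varP rm') = RM-unique rm rm'
  SSPiece-unique (funP ts↓ rm) (funP ts↓' rm') with NF*-unique ts↓ ts↓'
  ... | refl = RM-unique rm rm'

  irreducible-args : ∀ {n} {ts : Vec (Term sig) n} →
                     (∀ {u v ts'} → R u v → ¬ OneArg (StepAt u v) ts ts') →
                     ∃ λ (Ms : Vec Bag n) →
                       VP.Pointwise (NF R) ts ts × VP.Pointwise (RM R) ts Ms × concat (toList Ms) ≡ []
  irreducible-args {ts = []} _ = [] , VP.[] , VP.[] , refl
  irreducible-args {ts = t ∷ ts} no-step with irreducible-args {ts = ts} (λ r st → no-step r (there st))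
  ... | Ms , ts↓ , rms , ≡[] = [] ∷ Ms , done t-irreducible VP.∷ ts↓ , done t-irreducible VP.∷ rms , ≡[]
    where
    t-irreducible : Irreducible R t
    t-irreducible r (_ , st) = no-step r (here st)

  RM-args-step : ∀ {n} {ts ts' nfs : Vec (Term sig) n} {Ms' : Vec Bag n} →
                 R u v → OneArg (StepAt u v) ts ts' →
                 VP.Pointwise (NF R) ts' nfs → VP.Pointwise (RM R) ts' Ms' →
                 ∃ λ (Ms : Vec Bag n) →
                   VP.Pointwise (NF R) ts nfs × VP.Pointwise (RM R) ts Ms ×
                   concat (toList Ms) ↭ dbl u ∷ concat (toList Ms')
  RM-args-step r (here st) (t↓ VP.∷ ts↓) (rm VP.∷ rms) =
    _ , step r st t↓ VP.∷ ts↓ , step r st rm VP.∷ rms , ↭-refl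
  RM-args-step r (there st) (t↓ VP.∷ ts↓) (VP._∷_ {y = M} rm rms) with RM-args-step r st ts↓ rms
  ... | Ms , ts↓' , rms' , Ms↭ =
    M ∷ Ms , t↓ VP.∷ ts↓' , rm VP.∷ rms' , ↭-trans (++⁺ˡ M Ms↭) (shift _ M _)

  FunSplit : ∀ f → Vec (Term sig) (arity sig f) → List (List (Term sig)) → Set
  FunSplit f ts M = ∃₂ λ nfs M₀ → ∃ λ (Ms : Vec Bag (arity sig f)) →
    VP.Pointwise (NF R) ts nfs × VP.Pointwise (RM R) ts Ms × RM R (fun f nfs) M₀ ×
    M ↭ M₀ ++ concat (toList Ms)

  RM-fun-split : RM R (fun f ts) M → FunSplit f ts M
  RM-fun-split {f = f} (done irreducible) with irreducible-args (λ r st → irreducible r (_ , arg f st))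
  ... | Ms , ts↓ , rms , ≡[] = _ , [] , Ms , ts↓ , rms , done irreducible , ↭-reflexive (sym ≡[])
  RM-fun-split {M = M} (step r root rm) with irreducible-args (λ r' → lhs-args-irreducible r r')
  ... | Ms , ts↓ , rms , ≡[] =
    _ , M , Ms , ts↓ , rms , step r root rm ,
    ↭-reflexive (sym (trans (cong (M ++_) ≡[]) (++-identityʳ M)))
  RM-fun-split (step r (arg f st) rm) with RM-fun-split rm
  ... | nfs , M₀ , Ms' , ts'↓ , rms' , rm₀ , M↭ with RM-args-step r st ts'↓ rms'
  ...   | Ms , ts↓ , rms , Ms↭ =
    nfs , M₀ , Ms , ts↓ , rms , rm₀ ,
    ↭-trans (prep _ M↭) (↭-trans (↭-sym (shift _ M₀ _)) (++⁺ˡ M₀ (↭-sym Ms↭)))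

  SplitsAlong : Subst sig → List (Term sig) → List (List (Term sig)) → Set
  SplitsAlong θ ws M = ∃ λ Ms → Pointwise (SSPiece R θ) ws Ms × M ↭ concat Ms

  SplitsAlong-[] : SplitsAlong θ [] []
  SplitsAlong-[] = [] , [] , ↭-refl

  SSPiece⇒SplitsAlong : SSPiece R θ w M → SplitsAlong θ [ w ] M
  SSPiece⇒SplitsAlong {M = M} piece = [ M ] , piece ∷ [] , ↭-reflexive (sym (++-identityʳ M))

  SplitsAlong-++ : SplitsAlong θ ws M → SplitsAlong θ ws' M' → SplitsAlong θ (ws ++ ws') (M ++ M')
  SplitsAlong-++ (Ms , pieces , M↭) (Ms' , pieces' , M'↭) =
    Ms ++ Ms' , Pointwise.++⁺ pieces pieces' , ↭-trans (++⁺ M↭ M'↭) (↭-reflexive (concat-++ Ms Ms'))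

  SplitsAlong-resp-↭ : M ↭ M' → SplitsAlong θ ws M → SplitsAlong θ ws M'
  SplitsAlong-resp-↭ M↭M' (Ms , pieces , M↭) = Ms , pieces , ↭-trans (↭-sym M↭M') M↭

  RM-⟨⟩-split : ∀ θ w → RM R (w ⟨ θ ⟩) M → SplitsAlong θ (subterms w) M
  RM-⟨⟩*-split : ∀ θ (ws : Vec (Term sig) n) {Ms : Vec Bag n} →
                 VP.Pointwise (RM R) (ws ⟨ θ ⟩*) Ms →
                 SplitsAlong θ (subterms* ws) (concat (toList Ms))
  RM-⟨⟩-split θ (var x) rm = SSPiece⇒SplitsAlong (varP rm)
  RM-⟨⟩-split θ (fun f ws) rm with RM-fun-split rm
  ... | nfs , M₀ , Ms , ws↓ , rms , rm₀ , M↭ =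
    SplitsAlong-resp-↭ (↭-sym M↭)
      (SplitsAlong-++ (SSPiece⇒SplitsAlong (funP ws↓ rm₀)) (RM-⟨⟩*-split θ ws rms))
  RM-⟨⟩*-split θ [] VP.[] = SplitsAlong-[]
  RM-⟨⟩*-split θ (w ∷ ws) (rm VP.∷ rms) = SplitsAlong-++ (RM-⟨⟩-split θ w rm) (RM-⟨⟩*-split θ ws rms)

-- Clauses and the Equality Factoring step

module _ {sig : Signature} where

  private variable
    C D : Clause sig
    t : Term sig
    σ θ θ' : Subst sig
    P : Term sig → Set
    S : List (Term sig)

  enumeration-sound : Enumerates P S → t ∈ S → P t
  enumeration-sound (_ , members) = Equivalence.to (members _)

  enumeration-complete : Enumerates P S → P t → t ∈ S
  enumeration-complete (_ , members) = Equivalence.from (members _)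

  InTS⁻-++⁺ˡ : InTS⁻ C t → InTS⁻ (C ++ D) t
  InTS⁻-++⁺ˡ (a , b , L∈C , side) = a , b , ∈-++⁺ˡ L∈C , side

  InTS⁻-++⁻ : (C : Clause sig) → InTS⁻ (C ++ D) t → InTS⁻ C t ⊎ InTS⁻ D t
  InTS⁻-++⁻ C (a , b , L∈ , side) =
    Sum.map (λ L∈C → a , b , L∈C , side) (λ L∈D → a , b , L∈D , side) (∈-++⁻ C L∈)

  InTS⁻-⟨⟩ : InTS⁻ (C ⟨ σ ⟩ᶜ) t → ∃ λ t₀ → InTS⁻ C t₀ × t ≡ t₀ ⟨ σ ⟩
  InTS⁻-⟨⟩ (a , b , L∈ , side) with ∈-map⁻ _ L∈
  ... | pos _ _ , _ , ()
  ... | neg a₀ b₀ , L∈C , refl with side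
  ...   | inj₁ refl = a₀ , (a₀ , b₀ , L∈C , inj₁ refl) , refl
  ...   | inj₂ refl = b₀ , (a₀ , b₀ , L∈C , inj₂ refl) , refl

  posPairs-++ : (C D : Clause sig) (θ : Subst sig) → posPairs (C ++ D) θ ≡ posPairs C θ ++ posPairs D θ
  posPairs-++ [] D θ = refl
  posPairs-++ (pos a b ∷ C) D θ = cong (_ ∷_) (posPairs-++ C D θ)
  posPairs-++ (neg a b ∷ C) D θ = posPairs-++ C D θ

  posPairs-⟨⟩ : (C : Clause sig) → posPairs (C ⟨ σ ⟩ᶜ) θ ≡ posPairs C (σ ⨾ θ)
  posPairs-⟨⟩ [] = refl
  posPairs-⟨⟩ {σ} {θ} (pos a b ∷ C) =
    cong₂ _∷_ (cong₂ (λ x y → x ∷ y ∷ []) (⟨⟩-⨾ σ θ a) (⟨⟩-⨾ σ θ b)) (posPairs-⟨⟩ C)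
  posPairs-⟨⟩ (neg a b ∷ C) = posPairs-⟨⟩ C

  posPairs-cong : θ ≗ θ' → (C : Clause sig) → posPairs C θ ≡ posPairs C θ'
  posPairs-cong θ≗θ' [] = refl
  posPairs-cong θ≗θ' (pos a b ∷ C) =
    cong₂ _∷_ (cong₂ (λ x y → x ∷ y ∷ []) (⟨⟩-cong θ≗θ' a) (⟨⟩-cong θ≗θ' b)) (posPairs-cong θ≗θ' C)
  posPairs-cong θ≗θ' (neg a b ∷ C) = posPairs-cong θ≗θ' C

module EqFactoringStep {sig : Signature} (O : ReductionOrdering sig) (R : RewriteSystem sig)
    (R⊆≻ : ContainedIn O R) (R-left-reduced : LeftReduced R)
    (C' : Clause sig) (r r' s s' : Term sig) (θ σ : Subst sig)
    (ground : GroundClause ((C' ++ pos r r' ∷ pos s s' ∷ []) ⟨ θ ⟩ᶜ))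
    (sθ≡rθ : s ⟨ θ ⟩ ≡ r ⟨ θ ⟩)
    (mgu : IsIdempotentMGU σ s r)
    (sθ≻s'θ : ReductionOrdering._≻_ O (s ⟨ θ ⟩) (s' ⟨ θ ⟩))
    (maximal : Orders.Maximal O (pos s s' ⟨ θ ⟩ˡ) ((C' ++ pos r r' ∷ pos s s' ∷ []) ⟨ θ ⟩ᶜ)) where

  open ReductionOrdering O renaming (trans to ≻-trans)
  open Orders O
  open OrderingFacts O
  open GroundRewriting O R R⊆≻ R-left-reduced

  private variable
    t u w : Term sig
    S S₁ S₂ T₁ T₂ T₁' T₂' : List (Term sig)
    M M' : List (List (Term sig))
    Ms Ms₁ Ms₂ : List (List (List (Term sig)))
    N₁ N₂ : List (List (Term sig))

  premise conclusion : Clause sig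
  premise = C' ++ pos r r' ∷ pos s s' ∷ []
  conclusion = (C' ++ neg s' r' ∷ pos r r' ∷ []) ⟨ σ ⟩ᶜ

  σ⨾θ≗θ : σ ⨾ θ ≗ θ
  σ⨾θ≗θ = idempotent-mgu-absorbed {s = s} {t = r} mgu sθ≡rθ

  r'θ-ground : Ground (r' ⟨ θ ⟩)
  r'θ-ground = proj₂ (All.lookup ground (∈-map⁺ _⟨ θ ⟩ˡ (∈-++⁺ʳ C' (here refl))))

  s'θ-ground : Ground (s' ⟨ θ ⟩)
  s'θ-ground = proj₂ (All.lookup ground (∈-map⁺ _⟨ θ ⟩ˡ (∈-++⁺ʳ C' (there (here refl)))))

  sθ≻r'θ : s ⟨ θ ⟩ ≻ r' ⟨ θ ⟩
  sθ≻r'θ with total r'θ-ground s'θ-ground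
  ... | inj₁ r'θ≡s'θ = subst (s ⟨ θ ⟩ ≻_) (sym r'θ≡s'θ) sθ≻s'θ
  ... | inj₂ (inj₂ s'θ≻r'θ) = ≻-trans sθ≻s'θ s'θ≻r'θ
  ... | inj₂ (inj₁ r'θ≻s'θ) = ⊥-elim (maximal (∈-map⁺ _⟨ θ ⟩ˡ (∈-++⁺ʳ C' (here refl))) rr'θ≻ss'θ)
    where
    rr'θ≻ss'θ : pos r r' ⟨ θ ⟩ˡ ≻L pos s s' ⟨ θ ⟩ˡ
    rr'θ≻ss'θ = [ r ⟨ θ ⟩ ] , [ s ⟨ θ ⟩ ] , [ r' ⟨ θ ⟩ ] , [ s' ⟨ θ ⟩ ] , ↭-refl , ↭-refl ,
                sym sθ≡rθ ∷ [] , (λ ()) , here r'θ≻s'θ ∷ []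

  NewSide : Term sig → Set
  NewSide t = t ≡ s' ⊎ t ≡ r'

  BelowNewSide : Term sig → Set
  BelowNewSide w = ∃ λ t → NewSide t × w ⊴ t ⟨ σ ⟩

  newSide-below-sθ : NewSide t → Ground (t ⟨ θ ⟩) × s ⟨ θ ⟩ ≻ t ⟨ θ ⟩
  newSide-below-sθ (inj₁ refl) = s'θ-ground , sθ≻s'θ
  newSide-below-sθ (inj₂ refl) = r'θ-ground , sθ≻r'θ

  belowNewSide-below-sθ : BelowNewSide w → Ground (w ⟨ θ ⟩) × s ⟨ θ ⟩ ≻ w ⟨ θ ⟩
  belowNewSide-below-sθ {w} (t , new , w⊴tσ) with newSide-below-sθ new
  ... | tθ-ground , sθ≻tθ = Ground-⊴ wθ⊴tθ tθ-ground , ≻-⪰-trans sθ≻tθ (⊴⇒⪰ tθ-ground wθ⊴tθ)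
    where
    wθ⊴tθ : w ⟨ θ ⟩ ⊴ t ⟨ θ ⟩
    wθ⊴tθ = subst (w ⟨ θ ⟩ ⊴_) (⟨⟩-absorb σ⨾θ≗θ t) (⊴-⟨⟩ θ w⊴tσ)

  maximalPair : List (Term sig)
  maximalPair = litMS (pos s s' ⟨ θ ⟩ˡ)

  maximalPair-≻ₘ : ∀ {ys} → All (s ⟨ θ ⟩ ≻_) ys → maximalPair ≻ₘ ys
  maximalPair-≻ₘ sθ≻ys = ⊑⇒MulExt refl (All⇒⊑ sθ≻ys)

  ssPiece-negligible : BelowNewSide w → SSPiece R θ w M → All (maximalPair ≻ₘ_) M
  ssPiece-negligible w-below piece with belowNewSide-below-sθ w-below
  ... | wθ-ground , sθ≻wθ =
    All.map (maximalPair-≻ₘ ∘ All.map (≻-⪰-trans sθ≻wθ)) (SSPiece-bounded wθ-ground piece)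

  -- The members of ss⁻(C'σ) accounted for by u ∈ ss⁻(C').
  instSubterms : Term sig → List (Term sig)
  instSubterms (var x) = subterms (σ x)
  instSubterms (fun f ts) = [ fun f ts ⟨ σ ⟩ ]

  instSubterms-split : SSPiece R θ u M → SplitsAlong θ (instSubterms u) M
  instSubterms-split (varP {x} rm) = RM-⟨⟩-split θ (σ x) (subst (λ t → RM R t _) (sym (σ⨾θ≗θ x)) rm)
  instSubterms-split (funP {ts = ts} ts↓ rm) =
    SSPiece⇒SplitsAlong
      (funP (subst (λ us → VP.Pointwise (NF R) us _) (sym (⟨⟩*-absorb σ⨾θ≗θ ts)) ts↓) rm)

  premise-ss⁻-split : Pointwise (SSPiece R θ) S Ms → SplitsAlong θ (concatMap instSubterms S) (concat Ms)
  premise-ss⁻-split [] = SplitsAlong-[]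
  premise-ss⁻-split (piece ∷ pieces) =
    SplitsAlong-++ (instSubterms-split piece) (premise-ss⁻-split pieces)

  conclusion-ts⁻-source : InTS⁻ conclusion t → ∃ λ t₀ → t ≡ t₀ ⟨ σ ⟩ × (InTS⁻ premise t₀ ⊎ NewSide t₀)
  conclusion-ts⁻-source t∈ts⁻ with InTS⁻-⟨⟩ t∈ts⁻
  ... | t₀ , t₀∈ts⁻ , refl = t₀ , refl , Sum.map InTS⁻-++⁺ˡ factored (InTS⁻-++⁻ C' t₀∈ts⁻)
    where
    factored : InTS⁻ (neg s' r' ∷ pos r r' ∷ []) t₀ → NewSide t₀
    factored (_ , _ , here refl , side) = side
    factored (_ , _ , there (here ()) , _)
    factored (_ , _ , there (there ()) , _)

  ∈-instSubterms : Enumerates (InSS⁻ premise) S → InSS⁻ premise u → w ∈ instSubterms u →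
                   w ∈ concatMap instSubterms S
  ∈-instSubterms S-enum u∈ss⁻ w∈ =
    ∈-concat⁺′ w∈ (∈-map⁺ instSubterms (enumeration-complete S-enum u∈ss⁻))

  conclusion-ss⁻-source : Enumerates (InSS⁻ premise) S → InSS⁻ conclusion w →
                          w ∈ concatMap instSubterms S ⊎ BelowNewSide w
  conclusion-ss⁻-source S-enum (t , t∈ts⁻ , w⊴t) with conclusion-ts⁻-source t∈ts⁻
  ... | t₀ , refl , inj₂ new = inj₂ (t₀ , new , w⊴t)
  ... | t₀ , refl , inj₁ t₀∈ts⁻ with ⊴-⟨⟩⁻ t₀ w⊴t
  ...   | inj₁ (f , ts , u⊴t₀ , refl) = inj₁ (∈-instSubterms S-enum (t₀ , t₀∈ts⁻ , u⊴t₀) (here refl))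
  ...   | inj₂ (x , x⊴t₀ , w⊴σx) = inj₁ (∈-instSubterms S-enum (t₀ , t₀∈ts⁻ , x⊴t₀) (⊴⇒∈subterms w⊴σx))

  module SS = Pieces (SSPiece R θ) SSPiece-unique BelowNewSide (maximalPair ≻ₘ_) ssPiece-negligible

  ss⁻-contributions-⊑ : Enumerates (InSS⁻ premise) S₁ → Pointwise (SSPiece R θ) S₁ Ms₁ →
                        Enumerates (InSS⁻ conclusion) S₂ → Pointwise (SSPiece R θ) S₂ Ms₂ →
                        concat Ms₂ ⊑[ maximalPair ≻ₘ_ ] concat Ms₁
  ss⁻-contributions-⊑ S₁-enum pieces₁ S₂-enum pieces₂ with premise-ss⁻-split pieces₁
  ... | Ls , pieces₁' , Ms₁↭Ls =
    ⊑-respʳ (↭-sym Ms₁↭Ls)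
      (SS.concat-⊑ (proj₁ S₂-enum) pieces₂ pieces₁'
        (conclusion-ss⁻-source S₁-enum ∘ enumeration-sound S₂-enum))

  NFθ : Term sig → Term sig → Set
  NFθ t nf = NF R (t ⟨ θ ⟩) nf

  TSPiece : Term sig → List (List (Term sig)) → Set
  TSPiece t M = ∃ λ nf → NFθ t nf × M ≡ [ dbl nf ]

  TSPiece-unique : TSPiece t M → TSPiece t M' → M ↭ M'
  TSPiece-unique (_ , t↓ , refl) (_ , t↓' , refl) = ↭-reflexive (cong ([_] ∘ dbl) (NF-unique t↓ t↓'))

  tsPiece-negligible : BelowNewSide w → TSPiece w M → All (maximalPair ≻ₘ_) M
  tsPiece-negligible w-below (nf , w↓ , refl) with belowNewSide-below-sθ w-below
  ... | _ , sθ≻wθ = maximalPair-≻ₘ (sθ≻nf ∷ sθ≻nf ∷ []) ∷ []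
    where
    sθ≻nf = ≻-⪰-trans sθ≻wθ (NF⇒⪰ w↓)

  NF⇒TSPieces : Pointwise NFθ S T₁ → Pointwise TSPiece S (map [_] (map dbl T₁))
  NF⇒TSPieces [] = []
  NF⇒TSPieces (t↓ ∷ ts↓) = (_ , t↓ , refl) ∷ NF⇒TSPieces ts↓

  NF⇒TSPieces-⟨σ⟩ : Pointwise NFθ S T₁ → Pointwise TSPiece (map _⟨ σ ⟩ S) (map [_] (map dbl T₁))
  NF⇒TSPieces-⟨σ⟩ [] = []
  NF⇒TSPieces-⟨σ⟩ (_∷_ {x = t} t↓ ts↓) =
    (_ , subst (λ u → NF R u _) (sym (⟨⟩-absorb σ⨾θ≗θ t)) t↓ , refl) ∷ NF⇒TSPieces-⟨σ⟩ ts↓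

  module TS = Pieces TSPiece (λ {t} → TSPiece-unique {t = t}) BelowNewSide (maximalPair ≻ₘ_)
                     (λ {w} → tsPiece-negligible {w = w})

  ts⁻-contributions-⊑ : Enumerates (InTS⁻ premise) T₁ → Pointwise NFθ T₁ T₁' →
                        Enumerates (InTS⁻ conclusion) T₂ → Pointwise NFθ T₂ T₂' →
                        map dbl T₂' ⊑[ maximalPair ≻ₘ_ ] map dbl T₁'
  ts⁻-contributions-⊑ {T₁ = T₁} {T₁' = T₁'} {T₂ = T₂} {T₂' = T₂'} T₁-enum nfs₁ T₂-enum nfs₂ =
    subst₂ _⊑[ maximalPair ≻ₘ_ ]_ (concat-map-[ map dbl T₂' ]) (concat-map-[ map dbl T₁' ])
      (TS.concat-⊑ (proj₁ T₂-enum) (NF⇒TSPieces nfs₂) (NF⇒TSPieces-⟨σ⟩ nfs₁) classify)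
    where
    classify : ∀ {t} → t ∈ T₂ → t ∈ map _⟨ σ ⟩ T₁ ⊎ BelowNewSide t
    classify t∈T₂ with conclusion-ts⁻-source (enumeration-sound T₂-enum t∈T₂)
    ... | t₀ , refl , inj₁ t₀∈ts⁻ = inj₁ (∈-map⁺ _⟨ σ ⟩ (enumeration-complete T₁-enum t₀∈ts⁻))
    ... | t₀ , refl , inj₂ new = inj₂ (t₀ , new , here)

  sharedPairs : List (List (Term sig))
  sharedPairs = posPairs C' θ ++ [ r ⟨ θ ⟩ ∷ r' ⟨ θ ⟩ ∷ [] ]

  posPairs-premise : posPairs premise θ ≡ sharedPairs ++ [ maximalPair ]
  posPairs-premise =
    trans (posPairs-++ C' (pos r r' ∷ pos s s' ∷ []) θ) (sym (++-assoc (posPairs C' θ) _ _))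

  posPairs-conclusion : posPairs conclusion θ ≡ sharedPairs
  posPairs-conclusion = begin
    posPairs conclusion θ                   ≡⟨ posPairs-⟨⟩ unfactored ⟩
    posPairs unfactored (σ ⨾ θ)             ≡⟨ posPairs-cong σ⨾θ≗θ unfactored ⟩
    posPairs unfactored θ                   ≡⟨ posPairs-++ C' (neg s' r' ∷ pos r r' ∷ []) θ ⟩
    sharedPairs                             ∎
    where
    open ≡-Reasoning
    unfactored = C' ++ neg s' r' ∷ pos r r' ∷ []

  nm-decreases : NM R premise θ N₁ → NM R conclusion θ N₂ → N₁ ≻ₘₘ N₂
  nm-decreases {N₁} {N₂} (S₁ , Ms₁ , T₁ , T₁' , S₁-enum , pieces₁ , T₁-enum , nfs₁ , N₁↭)
                         (S₂ , Ms₂ , T₂ , T₂' , S₂-enum , pieces₂ , T₂-enum , nfs₂ , N₂↭) =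
    MulExt-respˡ-↭ (↭-sym N₁-split) (⊑⇒MulExt ↭-refl (⊑-respˡ (↭-sym N₂-split) shared))
    where
    A₁ = concat Ms₁
    B₁ = map dbl T₁'

    shared : concat Ms₂ ++ map dbl T₂' ++ sharedPairs ⊑[ maximalPair ≻ₘ_ ] A₁ ++ B₁ ++ sharedPairs
    shared = ⊑-++ (ss⁻-contributions-⊑ S₁-enum pieces₁ S₂-enum pieces₂)
                  (⊑-++ (ts⁻-contributions-⊑ T₁-enum nfs₁ T₂-enum nfs₂) ⊑-refl)

    N₂-split : N₂ ↭ concat Ms₂ ++ map dbl T₂' ++ sharedPairs
    N₂-split = subst (λ P → N₂ ↭ concat Ms₂ ++ map dbl T₂' ++ P) posPairs-conclusion N₂↭

    N₁-split : N₁ ↭ maximalPair ∷ A₁ ++ B₁ ++ sharedPairs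
    N₁-split = begin
      N₁                                              ↭⟨ N₁↭ ⟩
      A₁ ++ B₁ ++ posPairs premise θ                  ≡⟨ cong (λ P → A₁ ++ B₁ ++ P) posPairs-premise ⟩
      A₁ ++ B₁ ++ sharedPairs ++ [ maximalPair ]      ↭⟨ ++⁺ˡ A₁ (++⁺ˡ B₁ (∷↭∷ʳ maximalPair sharedPairs)) ⟨
      A₁ ++ B₁ ++ maximalPair ∷ sharedPairs           ↭⟨ ++⁺ˡ A₁ (shift maximalPair B₁ sharedPairs) ⟩
      A₁ ++ maximalPair ∷ B₁ ++ sharedPairs           ↭⟨ shift maximalPair A₁ _ ⟩
      maximalPair ∷ A₁ ++ B₁ ++ sharedPairs           ∎
      where open PermutationReasoning

lemma16 : {sig : Signature} (O : ReductionOrdering sig) (R : RewriteSystem sig)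
          (_≻Clo_ : Closure sig → Closure sig → Set) →
          IsClosureOrder _≻Clo_ →
          ContainedIn O R → LeftReduced R →
          (prem concl : Closure sig) → GroundEqFactoring O prem concl →
          NonHorn._≻≻_ O R _≻Clo_ prem concl
lemma16 O R _ _ R⊆≻ R-left-reduced _ _
  record { C' = C' ; r = r ; r' = r' ; s = s ; s' = s' ; θ = θ ; σ = σ ; prem≡ = refl ; concl≡ = refl
         ; ground = ground ; sθ≡rθ = sθ≡rθ ; mgu = mgu ; sθ≻s'θ = sθ≻s'θ ; maximal = maximal }
  nm₁ nm₂ = inj₁ (nm-decreases nm₁ nm₂)
  where
  open EqFactoringStep O R R⊆≻ R-left-reduced C' r r' s s' θ σ ground sθ≡rθ mgu sθ≻s'θ maximal
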